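{- Let $G=(V,E)$ be a triangle-free graph of maximum degree at most 3, let $U=\mathcal{R}^{(3)}(G)$, let $k$ be a positive integer and $\epsilon>0$, and let $\mathcal{C}$ be a $k$-clustering of $U$ of minimum total impurity. If every vertex cover of $G$ has size $\ge k(1+\epsilon)$, then there exists a constant $\eta>0$, depending only on $\epsilon$, such that $I_{Ent}(\mathcal{C})\ge\kappa(1+\eta)$, where $\kappa=6k+3(|U|-2k)\log 3$.
   Context: Graphs are simple and undirected. For $G$ with vertices $v_1,\dots,v_n$, $U=\mathcal{R}^{(3)}(G)=\{v^e:e\in E\}\subseteq\mathbb{R}^n$, where for $e=(v_i,v_j)$ the vector $v^e$ has 1 in coordinates $i$ and $j$ and 0 elsewhere. For $\mathbf{w}\in\mathbb{R}^n_{\ge0}$, $I_{Ent}(\mathbf{w})=\|\mathbf{w}\|_1\sum_i\frac{w_i}{\|\mathbf{w}\|_1}\log\frac{\|\mathbf{w}\|_1}{w_i}$ (base-2 logarithm, zero terms omitted); for $C\subseteq U$, $I_{Ent}(C)=I_{Ent}(\sum_{\mathbf{v}\in C}\mathbf{v})$. A $k$-clustering of $U$ is a partition $\mathcal{C}$ of $U$ into $k$ nonempty clusters, with total impurity $I_{Ent}(\mathcal{C})=\sum_{C\in\mathcal{C}}I_{Ent}(C)$. (The value $\kappa$ is the impurity of a $k$-clustering of $U$ consisting only of 2-stars and 3-stars, i.e., clusters of 2 or 3 edges sharing a common vertex.)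
   Formalization: The parameter ε ranges only over the positive rationals, and the constant η is taken among the positive rationals as well. -}

module Defs where

open import Data.Nat using (ℕ; zero; suc; _+_; _*_; _^_; _∸_; _≤_)
open import Data.Fin using (Fin; zero; suc)
open import Data.Fin.Properties using (_≟_)
open import Data.Fin.Subset using (Subset; _∈_; ∣_∣)
open import Data.Product using (_×_; _,_; proj₁; proj₂; ∃)
open import Data.Sum using (_⊎_)
open import Relation.Binary.PropositionalEquality using (_≡_; _≢_)
open import Relation.Nullary using (¬_)
open import Relation.Nullary.Decidable using (⌊_⌋)
open import Data.Bool using (if_then_else_)

sumFin : (n : ℕ) → (Fin n → ℕ) → ℕ
sumFin zero    f = 0
sumFin (suc n) f = f zero + sumFin n (λ i → f (suc i))

prodFin : (n : ℕ) → (Fin n → ℕ) → ℕ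
prodFin zero    f = 1
prodFin (suc n) f = f zero * prodFin n (λ i → f (suc i))

ind : ∀ {n} → Fin n → Fin n → ℕ
ind i j = if ⌊ i ≟ j ⌋ then 1 else 0

record Graph (n : ℕ) : Set where
  field
    m    : ℕ
    edge : Fin m → Fin n × Fin n
open Graph public

SameEdge : ∀ {n} → Fin n × Fin n → Fin n × Fin n → Set
SameEdge (a , b) (c , d) = (a ≡ c × b ≡ d) ⊎ (a ≡ d × b ≡ c)

Simple : ∀ {n} → Graph n → Set
Simple G = (∀ e → proj₁ (edge G e) ≢ proj₂ (edge G e))
         × (∀ e e′ → SameEdge (edge G e) (edge G e′) → e ≡ e′)

Adj : ∀ {n} → Graph n → Fin n → Fin n → Set
Adj G u v = ∃ λ e → SameEdge (edge G e) (u , v)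

TriangleFree : ∀ {n} → Graph n → Set
TriangleFree G = ∀ u v w → Adj G u v → Adj G v w → ¬ Adj G u w

vecE : ∀ {n} (G : Graph n) → Fin (m G) → Fin n → ℕ
vecE G e i = ind i (proj₁ (edge G e)) + ind i (proj₂ (edge G e))

degree : ∀ {n} (G : Graph n) → Fin n → ℕ
degree G i = sumFin (m G) (λ e → vecE G e i)

MaxDegreeAtMost3 : ∀ {n} → Graph n → Set
MaxDegreeAtMost3 {n} G = ∀ (i : Fin n) → degree G i ≤ 3

VertexCover : ∀ {n} → Graph n → Subset n → Set
VertexCover G S = ∀ e → proj₁ (edge G e) ∈ S ⊎ proj₂ (edge G e) ∈ S

-- U = R^(3)(G) = { v^e : e ∈ E }, |U| = m G (distinct edges give distinct vectors).
-- A k-clustering of U: a surjective labelling of the edges by Fin k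
-- (cluster j = { v^e : c e = j }, all k clusters nonempty).
Clustering : ∀ {n} → Graph n → ℕ → Set
Clustering G k = Fin (m G) → Fin k

IsKClustering : ∀ {n} (G : Graph n) (k : ℕ) → Clustering G k → Set
IsKClustering G k c = ∀ (j : Fin k) → ∃ λ e → c e ≡ j

clusterVec : ∀ {n} (G : Graph n) {k} → Clustering G k → Fin k → Fin n → ℕ
clusterVec G c j i = sumFin (m G) (λ e → if ⌊ c e ≟ j ⌋ then vecE G e i else 0)

clusterNorm : ∀ {n} (G : Graph n) {k} → Clustering G k → Fin k → ℕ
clusterNorm {n} G c j = sumFin n (clusterVec G c j)

-- Since all entries are natural numbers, 2^(I_Ent(C)) = impNum / impDen, where
--   I_Ent(w) = Σ_i w_i log₂(‖w‖₁ / w_i) = log₂ ( ‖w‖₁^‖w‖₁ / Π_i w_i^w_i )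
-- (zero terms omitted: 0^0 = 1 in ℕ), and the total impurity is the sum
-- over clusters, i.e. the log of the product.
impNum : ∀ {n} (G : Graph n) {k} → Clustering G k → ℕ
impNum G {k} c = prodFin k (λ j → clusterNorm G c j ^ clusterNorm G c j)

impDen : ∀ {n} (G : Graph n) {k} → Clustering G k → ℕ
impDen {n} G {k} c = prodFin k (λ j → prodFin n (λ i → clusterVec G c j i ^ clusterVec G c j i))

-- I_Ent(c) ≤ I_Ent(c′)  ⇔  impNum c / impDen c ≤ impNum c′ / impDen c′.
ImpLe : ∀ {n} (G : Graph n) {k} → Clustering G k → Clustering G k → Set
ImpLe G c c′ = impNum G c * impDen G c′ ≤ impNum G c′ * impDen G c

MinImpurity : ∀ {n} (G : Graph n) (k : ℕ) → Clustering G k → Set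
MinImpurity G k c = IsKClustering G k c × (∀ c′ → IsKClustering G k c′ → ImpLe G c c′)

-- Every vertex cover has size ≥ k (1 + p/q):  q |S| ≥ k (q + p).
CoverBound : ∀ {n} → Graph n → (k p q : ℕ) → Set
CoverBound {n} G k p q = ∀ (S : Subset n) → VertexCover G S → k * (q + p) ≤ q * ∣ S ∣

-- I_Ent(c) ≥ κ (1 + a/b), κ = 6k + 3(|U| - 2k) log₂ 3, exponentiated (base 2):
--   (impNum/impDen)^b ≥ 2^(6k(a+b)) · 3^(3(|U|-2k)(a+b)),
-- with the (possibly negative) power of 3 moved to the side where it is nonnegative.
ImpAtLeastKappa : ∀ {n} (G : Graph n) {k} → Clustering G k → (a b : ℕ) → Set
ImpAtLeastKappa G {k} c a b =
  impDen G c ^ b * 2 ^ (6 * k * (a + b)) * 3 ^ (3 * (m G ∸ 2 * k) * (a + b))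
    ≤ impNum G c ^ b * 3 ^ (3 * (2 * k ∸ m G) * (a + b))

-- Fix a cluster with e edges and let w be the sum of its edge vectors: w has entries at
-- most 3, Σ w = 2e, and since adjacent vertices of a triangle-free graph have disjoint
-- neighbourhoods, Σ w² ≤ e · |supp w| (the Mantel-type estimate).  From these constraints
-- alone, an exhaustive check for e < 9 and a crude estimate for e ≥ 9 show that the cluster
-- has impurity at least 6 + 3 (e - 2) log 3, the impurity of a 2- or 3-star, and at least
-- e / 10 more unless one vertex lies on all of its edges.  The centres of the star clusters
-- together with all vertices of the other clusters form a vertex cover, so a large minimum
-- vertex cover forces the non-star clusters to carry a fixed fraction of the edges, and
-- their bonus lifts the total impurity from κ to κ (1 + η).
module Submission where

open import Defs
open import Algebra.Properties.CommutativeSemigroup as CommutativeSemigroupProperties using ()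
open import Data.Bool using (true; if_then_else_)
open import Data.Empty using (⊥; ⊥-elim)
open import Data.Fin using (Fin; zero; suc)
import Data.Fin.Properties as Fin
open import Data.Fin.Subset using (Subset; _∈_; ∣_∣)
open import Data.Nat
  using (ℕ; zero; suc; _+_; _*_; _^_; _∸_; _⊓_; _≤_; _<_; _<ᵇ_; z≤n; s≤s; NonZero; allUpTo?)
open import Data.Nat.Properties
open import Data.Nat.Tactic.RingSolver using (solve-∀)
open import Data.Product using (_×_; _,_; proj₁; proj₂; ∃; ∃₂)
open import Data.Sum using (_⊎_; inj₁; inj₂)
import Data.Sum as Sum
open import Data.Unit using (tt)
open import Data.Vec using (tabulate)
open import Data.Vec.Properties using (lookup⇒[]=; lookup∘tabulate)
open import Function using (_∘_)
open import Relation.Binary.PropositionalEquality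
open import Relation.Nullary using (Dec; yes; no; _×-dec_; _→-dec_)
open import Relation.Nullary.Decidable using (⌊_⌋; toWitness)

open CommutativeSemigroupProperties +-commutativeSemigroup
  using () renaming (interchange to +-interchange)
open CommutativeSemigroupProperties *-commutativeSemigroup
  using () renaming (interchange to *-interchange; x∙yz≈y∙xz to *-left-comm)

+-positive : ∀ {x y} → 0 < x + y → 0 < x ⊎ 0 < y
+-positive {suc _} _   = inj₁ (s≤s z≤n)
+-positive {zero}  pos = inj₂ pos

*-positive : ∀ {x y} → 0 < x * y → 0 < x × 0 < y
*-positive {suc _} {suc _} _   = s≤s z≤n , s≤s z≤n
*-positive {suc x} {zero}  pos = ⊥-elim (n≮0 (subst (0 <_) (*-zeroʳ x) pos))

+-≤1 : ∀ {x y} → x ≤ 1 → y ≤ 1 → (0 < x → 0 < y → ⊥) → x + y ≤ 1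
+-≤1 {zero}          _         y≤1 _         = y≤1
+-≤1 {suc _} {zero}  (s≤s z≤n) _   _         = s≤s z≤n
+-≤1 {suc _} {suc _} _         _   exclusive = ⊥-elim (exclusive (s≤s z≤n) (s≤s z≤n))

≤1⇒≤ : ∀ {x y} → x ≤ 1 → (0 < x → 0 < y) → x ≤ y
≤1⇒≤ {zero}  _         _     = z≤n
≤1⇒≤ {suc _} (s≤s z≤n) x⁺⇒y⁺ = x⁺⇒y⁺ (s≤s z≤n)

^-distribʳ-* : ∀ x y n → (x * y) ^ n ≡ x ^ n * y ^ n
^-distribʳ-* x y zero    = refl
^-distribʳ-* x y (suc n) = trans (cong (x * y *_) (^-distribʳ-* x y n)) (*-interchange x y _ _)

sumFin-cong : ∀ n {f g : Fin n → ℕ} → (∀ i → f i ≡ g i) → sumFin n f ≡ sumFin n g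
sumFin-cong zero    f≗g = refl
sumFin-cong (suc n) f≗g = cong₂ _+_ (f≗g zero) (sumFin-cong n (f≗g ∘ suc))

sumFin-mono-≤ : ∀ n {f g : Fin n → ℕ} → (∀ i → f i ≤ g i) → sumFin n f ≤ sumFin n g
sumFin-mono-≤ zero    f≤g = z≤n
sumFin-mono-≤ (suc n) f≤g = +-mono-≤ (f≤g zero) (sumFin-mono-≤ n (f≤g ∘ suc))

sumFin-distrib-+ : ∀ n (f g : Fin n → ℕ) →
  sumFin n (λ i → f i + g i) ≡ sumFin n f + sumFin n g
sumFin-distrib-+ zero    f g = refl
sumFin-distrib-+ (suc n) f g =
  trans (cong (f zero + g zero +_) (sumFin-distrib-+ n (f ∘ suc) (g ∘ suc)))
        (+-interchange (f zero) (g zero) _ _)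

*-distribˡ-sumFin : ∀ n x (f : Fin n → ℕ) → x * sumFin n f ≡ sumFin n (λ i → x * f i)
*-distribˡ-sumFin zero    x f = *-zeroʳ x
*-distribˡ-sumFin (suc n) x f =
  trans (*-distribˡ-+ x (f zero) _) (cong (x * f zero +_) (*-distribˡ-sumFin n x (f ∘ suc)))

sumFin-const : ∀ n x → sumFin n (λ _ → x) ≡ n * x
sumFin-const zero    x = refl
sumFin-const (suc n) x = cong (x +_) (sumFin-const n x)

sumFin-zero : ∀ n {f : Fin n → ℕ} → (∀ i → f i ≡ 0) → sumFin n f ≡ 0
sumFin-zero n f≗0 = trans (sumFin-cong n f≗0) (trans (sumFin-const n 0) (*-zeroʳ n))

sumFin-comm : ∀ m n (f : Fin m → Fin n → ℕ) →
  sumFin m (λ i → sumFin n (f i)) ≡ sumFin n (λ j → sumFin m (λ i → f i j))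
sumFin-comm zero    n f = sym (sumFin-zero n (λ _ → refl))
sumFin-comm (suc m) n f =
  trans (cong (sumFin n (f zero) +_) (sumFin-comm m n (f ∘ suc)))
        (sym (sumFin-distrib-+ n (f zero) _))

term≤sumFin : ∀ n (f : Fin n → ℕ) i → f i ≤ sumFin n f
term≤sumFin (suc n) f zero    = m≤m+n (f zero) _
term≤sumFin (suc n) f (suc i) = m≤n⇒m≤o+n (f zero) (term≤sumFin n (f ∘ suc) i)

sumFin-positive : ∀ n (f : Fin n → ℕ) → 0 < sumFin n f → ∃ λ i → 0 < f i
sumFin-positive (suc n) f pos with f zero in eq
... | suc _ = zero , subst (0 <_) (sym eq) (s≤s z≤n)
... | zero  = let i , fi>0 = sumFin-positive n (f ∘ suc) pos in suc i , fi>0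

sumFin-≤1 : ∀ n (f : Fin n → ℕ) → (∀ i → f i ≤ 1) →
  (∀ i j → 0 < f i → 0 < f j → i ≡ j) → sumFin n f ≤ 1
sumFin-≤1 zero    f f≤1 unique = z≤n
sumFin-≤1 (suc n) f f≤1 unique with n≤1⇒n≡0∨n≡1 (f≤1 zero)
... | inj₁ f0≡0 = subst (λ x → x + sumFin n (f ∘ suc) ≤ 1) (sym f0≡0)
  (sumFin-≤1 n (f ∘ suc) (f≤1 ∘ suc) (λ i j p q → Fin.suc-injective (unique _ _ p q)))
... | inj₂ f0≡1 = ≤-reflexive (cong₂ _+_ f0≡1 (sumFin-zero n rest))
  where
  rest : ∀ i → f (suc i) ≡ 0
  rest i with n≤1⇒n≡0∨n≡1 (f≤1 (suc i))
  ... | inj₁ fi≡0 = fi≡0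
  ... | inj₂ fi≡1 with () ← unique zero (suc i) (≤-reflexive (sym f0≡1)) (≤-reflexive (sym fi≡1))

sumFin-tight : ∀ n {f g : Fin n → ℕ} → (∀ i → f i ≤ g i) → sumFin n g ≤ sumFin n f →
  ∀ i → g i ≤ f i
sumFin-tight (suc n) {f} {g} f≤g Σg≤Σf zero =
  +-cancelʳ-≤ (sumFin n (g ∘ suc)) (g zero) (f zero)
    (≤-trans Σg≤Σf (+-monoʳ-≤ (f zero) (sumFin-mono-≤ n (f≤g ∘ suc))))
sumFin-tight (suc n) {f} {g} f≤g Σg≤Σf (suc i) =
  sumFin-tight n (f≤g ∘ suc)
    (+-cancelˡ-≤ (g zero) _ _ (≤-trans Σg≤Σf (+-monoˡ-≤ (sumFin n (f ∘ suc)) (f≤g zero)))) i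

prodFin-cong : ∀ n {f g : Fin n → ℕ} → (∀ i → f i ≡ g i) → prodFin n f ≡ prodFin n g
prodFin-cong zero    f≗g = refl
prodFin-cong (suc n) f≗g = cong₂ _*_ (f≗g zero) (prodFin-cong n (f≗g ∘ suc))

prodFin-mono-≤ : ∀ n {f g : Fin n → ℕ} → (∀ i → f i ≤ g i) → prodFin n f ≤ prodFin n g
prodFin-mono-≤ zero    f≤g = ≤-refl
prodFin-mono-≤ (suc n) f≤g = *-mono-≤ (f≤g zero) (prodFin-mono-≤ n (f≤g ∘ suc))

prodFin-distrib-* : ∀ n (f g : Fin n → ℕ) →
  prodFin n (λ i → f i * g i) ≡ prodFin n f * prodFin n g
prodFin-distrib-* zero    f g = refl
prodFin-distrib-* (suc n) f g =
  trans (cong (f zero * g zero *_) (prodFin-distrib-* n (f ∘ suc) (g ∘ suc)))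
        (*-interchange (f zero) (g zero) _ _)

prodFin-^ : ∀ n (f : Fin n → ℕ) b → prodFin n (λ i → f i ^ b) ≡ prodFin n f ^ b
prodFin-^ zero    f b = sym (^-zeroˡ b)
prodFin-^ (suc n) f b =
  trans (cong (f zero ^ b *_) (prodFin-^ n (f ∘ suc) b)) (sym (^-distribʳ-* (f zero) _ b))

prodFin-pow : ∀ n x (g : Fin n → ℕ) → prodFin n (λ i → x ^ g i) ≡ x ^ sumFin n g
prodFin-pow zero    x g = refl
prodFin-pow (suc n) x g =
  trans (cong (x ^ g zero *_) (prodFin-pow n x (g ∘ suc))) (sym (^-distribˡ-+-* x (g zero) _))

ind-suc : ∀ {n} (a b : Fin n) → ind (suc a) (suc b) ≡ ind a b
ind-suc a b with a Fin.≟ b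
... | yes _ = refl
... | no  _ = refl

ind-refl : ∀ {n} (a : Fin n) → ind a a ≡ 1
ind-refl a with a Fin.≟ a
... | yes _   = refl
... | no  a≢a = ⊥-elim (a≢a refl)

ind⁺ : ∀ {n} {a b : Fin n} → 0 < ind a b → a ≡ b
ind⁺ {a = a} {b} pos with a Fin.≟ b
... | yes a≡b = a≡b
... | no  _   = ⊥-elim (n≮0 pos)

ind≤1 : ∀ {n} (a b : Fin n) → ind a b ≤ 1
ind≤1 a b with a Fin.≟ b
... | yes _ = ≤-refl
... | no  _ = z≤n

ind-comm : ∀ {n} (a b : Fin n) → ind a b ≡ ind b a
ind-comm a b with a Fin.≟ b | b Fin.≟ a
... | yes _   | yes _   = refl
... | no  _   | no  _   = refl
... | yes a≡b | no  b≢a = ⊥-elim (b≢a (sym a≡b))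
... | no  a≢b | yes b≡a = ⊥-elim (a≢b (sym b≡a))

sumFin-*-ind : ∀ n (f : Fin n → ℕ) a → sumFin n (λ i → f i * ind i a) ≡ f a
sumFin-*-ind (suc n) f zero = trans
  (cong₂ _+_ (*-identityʳ (f zero)) (sumFin-zero n (λ i → *-zeroʳ (f (suc i)))))
  (+-identityʳ (f zero))
sumFin-*-ind (suc n) f (suc a) = trans
  (cong₂ _+_ (*-zeroʳ (f zero)) (sumFin-cong n (λ i → cong (f (suc i) *_) (ind-suc i a))))
  (sumFin-*-ind n (f ∘ suc) a)

sumFin-ind : ∀ n (a : Fin n) → sumFin n (λ i → ind i a) ≡ 1
sumFin-ind n a =
  trans (sumFin-cong n (λ i → sym (*-identityˡ (ind i a)))) (sumFin-*-ind n (λ _ → 1) a)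

indℕ : ℕ → ℕ → ℕ
indℕ x v = if ⌊ x ≟ v ⌋ then 1 else 0

count : ∀ {n} → (Fin n → ℕ) → ℕ → ℕ
count {n} w v = sumFin n (λ i → indℕ (w i) v)

count-zero : ∀ {n} (w : Fin n → ℕ) v → (∀ i → w i ≢ v) → count w v ≡ 0
count-zero {n} w v w≢v = sumFin-zero n indℕ≡0
  where
  indℕ≡0 : ∀ i → indℕ (w i) v ≡ 0
  indℕ≡0 i with w i ≟ v
  ... | yes wi≡v = ⊥-elim (w≢v i wi≡v)
  ... | no  _    = refl

module _ (h : ℕ → ℕ) where

  splitByValue-+ : h 0 ≡ 0 → ∀ {x} → x ≤ 3 →
    h x ≡ h 1 * indℕ x 1 + h 2 * indℕ x 2 + h 3 * indℕ x 3
  splitByValue-+ h0≡0 z≤n                   = trans h0≡0 (at0 (h 1) (h 2) (h 3))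
    where at0 : ∀ a b c → 0 ≡ a * 0 + b * 0 + c * 0
          at0 = solve-∀
  splitByValue-+ _    (s≤s z≤n)             = at1 (h 1) (h 2) (h 3)
    where at1 : ∀ a b c → a ≡ a * 1 + b * 0 + c * 0
          at1 = solve-∀
  splitByValue-+ _    (s≤s (s≤s z≤n))       = at2 (h 1) (h 2) (h 3)
    where at2 : ∀ a b c → b ≡ a * 0 + b * 1 + c * 0
          at2 = solve-∀
  splitByValue-+ _    (s≤s (s≤s (s≤s z≤n))) = at3 (h 1) (h 2) (h 3)
    where at3 : ∀ a b c → c ≡ a * 0 + b * 0 + c * 1
          at3 = solve-∀

  splitByValue-* : h 0 ≡ 1 → ∀ {x} → x ≤ 3 →
    h x ≡ h 1 ^ indℕ x 1 * h 2 ^ indℕ x 2 * h 3 ^ indℕ x 3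
  splitByValue-* h0≡1 z≤n                   = h0≡1
  splitByValue-* _    (s≤s z≤n)             = at1 (h 1)
    where at1 : ∀ a → a ≡ a * 1 * 1 * 1
          at1 = solve-∀
  splitByValue-* _    (s≤s (s≤s z≤n))       = at2 (h 2)
    where at2 : ∀ b → b ≡ 1 * (b * 1) * 1
          at2 = solve-∀
  splitByValue-* _    (s≤s (s≤s (s≤s z≤n))) = at3 (h 3)
    where at3 : ∀ c → c ≡ 1 * 1 * (c * 1)
          at3 = solve-∀

  module _ {n} (w : Fin n → ℕ) (w≤3 : ∀ i → w i ≤ 3) where

    sumFin-byValue : h 0 ≡ 0 →
      sumFin n (λ i → h (w i)) ≡ h 1 * count w 1 + h 2 * count w 2 + h 3 * count w 3
    sumFin-byValue h0≡0 = begin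
      sumFin n (λ i → h (w i))
        ≡⟨ sumFin-cong n (λ i → splitByValue-+ h0≡0 (w≤3 i)) ⟩
      sumFin n (λ i → term 1 i + term 2 i + term 3 i)
        ≡⟨ sumFin-distrib-+ n _ (term 3) ⟩
      sumFin n (λ i → term 1 i + term 2 i) + sumFin n (term 3)
        ≡⟨ cong (_+ sumFin n (term 3)) (sumFin-distrib-+ n (term 1) (term 2)) ⟩
      sumFin n (term 1) + sumFin n (term 2) + sumFin n (term 3)
        ≡⟨ sym (cong₂ _+_ (cong₂ _+_ (*-distribˡ-sumFin n (h 1) _) (*-distribˡ-sumFin n (h 2) _))
                          (*-distribˡ-sumFin n (h 3) _)) ⟩
      h 1 * count w 1 + h 2 * count w 2 + h 3 * count w 3 ∎
      where
      open ≡-Reasoning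
      term : ℕ → Fin n → ℕ
      term v i = h v * indℕ (w i) v

    prodFin-byValue : h 0 ≡ 1 →
      prodFin n (λ i → h (w i)) ≡ h 1 ^ count w 1 * h 2 ^ count w 2 * h 3 ^ count w 3
    prodFin-byValue h0≡1 = begin
      prodFin n (λ i → h (w i))
        ≡⟨ prodFin-cong n (λ i → splitByValue-* h0≡1 (w≤3 i)) ⟩
      prodFin n (λ i → factor 1 i * factor 2 i * factor 3 i)
        ≡⟨ prodFin-distrib-* n _ (factor 3) ⟩
      prodFin n (λ i → factor 1 i * factor 2 i) * prodFin n (factor 3)
        ≡⟨ cong (_* prodFin n (factor 3)) (prodFin-distrib-* n (factor 1) (factor 2)) ⟩
      prodFin n (factor 1) * prodFin n (factor 2) * prodFin n (factor 3)
        ≡⟨ cong₂ _*_ (cong₂ _*_ (prodFin-pow n (h 1) _) (prodFin-pow n (h 2) _)) (prodFin-pow n (h 3) _) ⟩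
      h 1 ^ count w 1 * h 2 ^ count w 2 * h 3 ^ count w 3 ∎
      where
      open ≡-Reasoning
      factor : ℕ → Fin n → ℕ
      factor v i = h v ^ indℕ (w i) v

-- Impurity of a single cluster

-- Taking base-2 logarithms, the inequality says that log (N ^ N / D) is at least
-- 6 + 3 (e - 2) log 3 + x / 10; here 6 + 3 (e - 2) log 3 is the impurity of a 2- or 3-star
-- with e edges, N the norm of the cluster vector w and D = Π wᵢ ^ wᵢ.
StarImpurityBound : (D N e x : ℕ) → Set
StarImpurityBound D N e x = D ^ 10 * 2 ^ (x + 60) * 3 ^ (30 * e) ≤ (N ^ N) ^ 10 * 3 ^ 60

AbsentValue : (e n₁ n₂ n₃ : ℕ) → Set
AbsentValue e n₁ n₂ n₃ = (e ≡ 1 → n₁ ≡ 0) × (e ≡ 2 → n₂ ≡ 0) × (e ≡ 3 → n₃ ≡ 0)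

-- For e < 9 the identity n₁ + 2 n₂ + 3 n₃ = 2 e determines n₁ and forces n₂ < 9 and n₃ < 6,
-- so these cases are decided by evaluation.
SmallCase : (e n₂ n₃ : ℕ) → Set
SmallCase e n₂ n₃ = let n₁ = 2 * e ∸ (2 * n₂ + 3 * n₃) in
  n₁ + 2 * n₂ + 3 * n₃ ≡ 2 * e → n₁ + 4 * n₂ + 9 * n₃ ≤ (n₁ + n₂ + n₃) * e →
  StarImpurityBound (4 ^ n₂ * 27 ^ n₃) (2 * e) e 0 ×
  (AbsentValue e n₁ n₂ n₃ → StarImpurityBound (4 ^ n₂ * 27 ^ n₃) (2 * e) e e)

smallCase? : ∀ e n₂ n₃ → Dec (SmallCase e n₂ n₃)
smallCase? e n₂ n₃ = (_ ≟ _) →-dec ((_ ≤? _) →-dec ((_ ≤? _) ×-dec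
  ((((e ≟ 1) →-dec (_ ≟ 0)) ×-dec (((e ≟ 2) →-dec (n₂ ≟ 0)) ×-dec ((e ≟ 3) →-dec (n₃ ≟ 0))))
   →-dec (_ ≤? _))))

smallCases : ∀ {e} → e < 9 → ∀ {n₂} → n₂ < 9 → ∀ {n₃} → n₃ < 6 → SmallCase e n₂ n₃
smallCases = toWitness {a? = allUpTo? (λ e → allUpTo? (λ n₂ → allUpTo? (smallCase? e n₂) 6) 9) 9} tt

module _ {e n₁ n₂ n₃ : ℕ} (sum≡ : n₁ + 2 * n₂ + 3 * n₃ ≡ 2 * e) where

  private
    s : ℕ
    s = 2 * n₂ + 3 * n₃

    n₁+s≡2e : n₁ + s ≡ 2 * e
    n₁+s≡2e = trans (sym (+-assoc n₁ (2 * n₂) (3 * n₃))) sum≡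

    s≤2e : s ≤ 2 * e
    s≤2e = ≤-trans (m≤n+m s n₁) (≤-reflexive n₁+s≡2e)

  starImpurity-small : e < 9 → n₁ + 4 * n₂ + 9 * n₃ ≤ (n₁ + n₂ + n₃) * e →
    StarImpurityBound (4 ^ n₂ * 27 ^ n₃) (2 * e) e 0 ×
    (AbsentValue e n₁ n₂ n₃ → StarImpurityBound (4 ^ n₂ * 27 ^ n₃) (2 * e) e e)
  starImpurity-small e<9 squares≤ = subst Case n₁≡ (smallCases e<9 n₂<9 n₃<6) sum≡ squares≤
    where
    Case : ℕ → Set
    Case z = z + 2 * n₂ + 3 * n₃ ≡ 2 * e → z + 4 * n₂ + 9 * n₃ ≤ (z + n₂ + n₃) * e →
      StarImpurityBound (4 ^ n₂ * 27 ^ n₃) (2 * e) e 0 ×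
      (AbsentValue e z n₂ n₃ → StarImpurityBound (4 ^ n₂ * 27 ^ n₃) (2 * e) e e)
    n₁≡ : 2 * e ∸ s ≡ n₁
    n₁≡ = trans (cong (_∸ s) (sym n₁+s≡2e)) (m+n∸n≡m n₁ s)
    s≤16 : s ≤ 16
    s≤16 = ≤-trans s≤2e (*-monoʳ-≤ 2 (≤-pred e<9))
    n₂<9 : n₂ < 9
    n₂<9 = s≤s (*-cancelˡ-≤ 2 (≤-trans (m≤m+n (2 * n₂) (3 * n₃)) s≤16))
    n₃<6 : n₃ < 6
    n₃<6 = *-cancelˡ-< 3 n₃ 6 (s≤s (≤-trans (m≤n+m (3 * n₃) (2 * n₂)) (m≤n⇒m≤1+n s≤16)))

  valueProduct≤ : 4 ^ n₂ * 27 ^ n₃ ≤ 3 ^ (2 * e)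
  valueProduct≤ = begin
    4 ^ n₂ * 27 ^ n₃            ≤⟨ *-monoˡ-≤ (27 ^ n₃) (^-monoˡ-≤ n₂ (≤ᵇ⇒≤ 4 9 tt)) ⟩
    9 ^ n₂ * 27 ^ n₃            ≡⟨ cong₂ _*_ (^-*-assoc 3 2 n₂) (^-*-assoc 3 3 n₃) ⟩
    3 ^ (2 * n₂) * 3 ^ (3 * n₃) ≡⟨ sym (^-distribˡ-+-* 3 (2 * n₂) (3 * n₃)) ⟩
    3 ^ s                       ≤⟨ ^-monoʳ-≤ 3 s≤2e ⟩
    3 ^ (2 * e)                 ∎
    where open ≤-Reasoning

  -- For e ≥ 9 even the crude estimate D ≤ 3 ^ (2 e) leaves room for a bonus of e.
  starImpurity-large : ∀ {x} → 9 ≤ e → x ≤ e → StarImpurityBound (4 ^ n₂ * 27 ^ n₃) (2 * e) e x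
  starImpurity-large {x} 9≤e x≤e = begin
    (4 ^ n₂ * 27 ^ n₃) ^ 10 * 2 ^ (x + 60) * 3 ^ (30 * e)
      ≤⟨ *-monoˡ-≤ (3 ^ (30 * e)) (*-mono-≤ (^-monoˡ-≤ 10 valueProduct≤) (^-monoʳ-≤ 2 (+-monoˡ-≤ 60 x≤e))) ⟩
    (3 ^ (2 * e)) ^ 10 * 2 ^ (e + 60) * 3 ^ (30 * e)
      ≡⟨ cong₂ (λ a b → a * b * 3 ^ (30 * e)) (^-*-assoc 3 (2 * e) 10) (^-distribˡ-+-* 2 e 60) ⟩
    3 ^ (2 * e * 10) * (2 ^ e * 2 ^ 60) * 3 ^ (30 * e)
      ≡⟨ regroup (3 ^ (2 * e * 10)) (2 ^ e) (2 ^ 60) (3 ^ (30 * e)) ⟩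
    3 ^ (2 * e * 10) * 3 ^ (30 * e) * 2 ^ e * 2 ^ 60
      ≡⟨ cong (λ a → a * 2 ^ e * 2 ^ 60) (trans (sym (^-distribˡ-+-* 3 (2 * e * 10) (30 * e)))
                                         (trans (cong (3 ^_) (fifty e)) (sym (^-*-assoc 3 50 e)))) ⟩
    (3 ^ 50) ^ e * 2 ^ e * 2 ^ 60
      ≡⟨ cong (_* 2 ^ 60) (sym (^-distribʳ-* (3 ^ 50) 2 e)) ⟩
    (3 ^ 50 * 2) ^ e * 2 ^ 60
      ≤⟨ *-mono-≤ (^-monoˡ-≤ e (≤-trans (≤ᵇ⇒≤ (3 ^ 50 * 2) (18 ^ 20) tt) (^-monoˡ-≤ 20 (*-monoʳ-≤ 2 9≤e))))
                  (^-monoˡ-≤ 60 (≤ᵇ⇒≤ 2 3 tt)) ⟩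
    ((2 * e) ^ 20) ^ e * 3 ^ 60
      ≡⟨ cong (_* 3 ^ 60) (trans (^-*-assoc (2 * e) 20 e)
                          (trans (cong ((2 * e) ^_) (twenty e)) (sym (^-*-assoc (2 * e) (2 * e) 10)))) ⟩
    ((2 * e) ^ (2 * e)) ^ 10 * 3 ^ 60 ∎
    where
    open ≤-Reasoning
    regroup : ∀ a b c d → a * (b * c) * d ≡ a * d * b * c
    regroup = solve-∀
    fifty : ∀ e → 2 * e * 10 + 30 * e ≡ 50 * e
    fifty = solve-∀
    twenty : ∀ e → 20 * e ≡ 2 * e * 10
    twenty = solve-∀

  starImpurity : n₁ + 4 * n₂ + 9 * n₃ ≤ (n₁ + n₂ + n₃) * e →
    StarImpurityBound (4 ^ n₂ * 27 ^ n₃) (2 * e) e 0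
  starImpurity squares≤ with e <? 9
  ... | yes e<9 = proj₁ (starImpurity-small e<9 squares≤)
  ... | no  e≮9 = starImpurity-large (≮⇒≥ e≮9) z≤n

  nonStarImpurity : n₁ + 4 * n₂ + 9 * n₃ ≤ (n₁ + n₂ + n₃) * e → AbsentValue e n₁ n₂ n₃ →
    StarImpurityBound (4 ^ n₂ * 27 ^ n₃) (2 * e) e e
  nonStarImpurity squares≤ absent with e <? 9
  ... | yes e<9 = proj₂ (starImpurity-small e<9 squares≤) absent
  ... | no  e≮9 = starImpurity-large (≮⇒≥ e≮9) ≤-refl

-- Edge sets, stars and vertex covers

sameEdge-common : ∀ {n} {p q r : Fin n × Fin n} → SameEdge p r → SameEdge q r → SameEdge p q
sameEdge-common (inj₁ (a , b)) (inj₁ (c , d)) = inj₁ (trans a (sym c) , trans b (sym d))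
sameEdge-common (inj₁ (a , b)) (inj₂ (c , d)) = inj₂ (trans a (sym d) , trans b (sym c))
sameEdge-common (inj₂ (a , b)) (inj₁ (c , d)) = inj₂ (trans a (sym d) , trans b (sym c))
sameEdge-common (inj₂ (a , b)) (inj₂ (c , d)) = inj₁ (trans a (sym c) , trans b (sym d))

support : ∀ {n} → (Fin n → ℕ) → Subset n
support ρ = tabulate (λ i → 0 <ᵇ ρ i)

∣support∣≤sumFin : ∀ n (ρ : Fin n → ℕ) → ∣ support ρ ∣ ≤ sumFin n ρ
∣support∣≤sumFin zero    ρ = z≤n
∣support∣≤sumFin (suc n) ρ with ρ zero
... | zero  = ∣support∣≤sumFin n (ρ ∘ suc)
... | suc x = s≤s (m≤n⇒m≤o+n x (∣support∣≤sumFin n (ρ ∘ suc)))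

∈-support : ∀ {n} (ρ : Fin n → ℕ) {i} → 0 < ρ i → i ∈ support ρ
∈-support ρ {i} ρi⁺ =
  lookup⇒[]= i (support ρ) (trans (lookup∘tabulate (λ i → 0 <ᵇ ρ i) i) (<ᵇ-true ρi⁺))
  where
  <ᵇ-true : ∀ {x} → 0 < x → (0 <ᵇ x) ≡ true
  <ᵇ-true (s≤s _) = refl

module _ {n} (G : Graph n) where

  end₁ end₂ : Fin (m G) → Fin n
  end₁ e = proj₁ (edge G e)
  end₂ e = proj₂ (edge G e)

  Endpoint : Fin n → Fin (m G) → Set
  Endpoint i e = i ≡ end₁ e ⊎ i ≡ end₂ e

  sameEdge⇒endpoint : ∀ {e a i} → SameEdge (edge G e) (a , i) → Endpoint i e
  sameEdge⇒endpoint (inj₁ (_ , end₂≡i)) = inj₂ (sym end₂≡i)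
  sameEdge⇒endpoint (inj₂ (end₁≡i , _)) = inj₁ (sym end₁≡i)

  coverBound-weighted : ∀ {k p q} → CoverBound G k p q → (ρ : Fin n → ℕ) →
    (∀ e → 0 < ρ (end₁ e) ⊎ 0 < ρ (end₂ e)) → k * (q + p) ≤ q * sumFin n ρ
  coverBound-weighted {q = q} bound ρ covers =
    ≤-trans (bound (support ρ) (Sum.map (∈-support ρ) (∈-support ρ) ∘ covers))
            (*-monoʳ-≤ q (∣support∣≤sumFin n ρ))

  sumFin-*-vecE : ∀ (f : Fin n → ℕ) e → sumFin n (λ i → f i * vecE G e i) ≡ f (end₁ e) + f (end₂ e)
  sumFin-*-vecE f e = begin
    sumFin n (λ i → f i * vecE G e i)
      ≡⟨ sumFin-cong n (λ i → *-distribˡ-+ (f i) (ind i (end₁ e)) (ind i (end₂ e))) ⟩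
    sumFin n (λ i → f i * ind i (end₁ e) + f i * ind i (end₂ e))
      ≡⟨ sumFin-distrib-+ n _ _ ⟩
    sumFin n (λ i → f i * ind i (end₁ e)) + sumFin n (λ i → f i * ind i (end₂ e))
      ≡⟨ cong₂ _+_ (sumFin-*-ind n f (end₁ e)) (sumFin-*-ind n f (end₂ e)) ⟩
    f (end₁ e) + f (end₂ e) ∎
    where open ≡-Reasoning

  sumFin-vecE : ∀ e → sumFin n (vecE G e) ≡ 2
  sumFin-vecE e =
    trans (sumFin-distrib-+ n _ _) (cong₂ _+_ (sumFin-ind n (end₁ e)) (sumFin-ind n (end₂ e)))

  vecE-≤1 : ∀ {e} → end₁ e ≢ end₂ e → ∀ i → vecE G e i ≤ 1
  vecE-≤1 {e} loopless i = +-≤1 (ind≤1 i (end₁ e)) (ind≤1 i (end₂ e))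
    (λ p q → loopless (trans (sym (ind⁺ {a = i} p)) (ind⁺ {a = i} q)))

  vecE⁺ : ∀ {e i} → 0 < vecE G e i → Endpoint i e
  vecE⁺ pos = Sum.map ind⁺ ind⁺ (+-positive pos)

  endpoint⇒vecE⁺ : ∀ {e i} → Endpoint i e → 0 < vecE G e i
  endpoint⇒vecE⁺ {e} (inj₁ refl) = ≤-trans (≤-reflexive (sym (ind-refl (end₁ e)))) (m≤m+n _ _)
  endpoint⇒vecE⁺ {e} (inj₂ refl) = ≤-trans (≤-reflexive (sym (ind-refl (end₂ e)))) (m≤n+m _ _)

  joins : Fin (m G) → Fin n → Fin n → ℕ
  joins e a i = ind a (end₁ e) * ind i (end₂ e) + ind a (end₂ e) * ind i (end₁ e)

  sumFin-joins : ∀ e a → sumFin n (joins e a) ≡ vecE G e a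
  sumFin-joins e a = begin
    sumFin n (joins e a)
      ≡⟨ sumFin-distrib-+ n _ _ ⟩
    sumFin n (λ i → ind a x * ind i y) + sumFin n (λ i → ind a y * ind i x)
      ≡⟨ sym (cong₂ _+_ (*-distribˡ-sumFin n (ind a x) _) (*-distribˡ-sumFin n (ind a y) _)) ⟩
    ind a x * sumFin n (λ i → ind i y) + ind a y * sumFin n (λ i → ind i x)
      ≡⟨ cong₂ _+_ (cong (ind a x *_) (sumFin-ind n y)) (cong (ind a y *_) (sumFin-ind n x)) ⟩
    ind a x * 1 + ind a y * 1
      ≡⟨ cong₂ _+_ (*-identityʳ (ind a x)) (*-identityʳ (ind a y)) ⟩
    vecE G e a ∎
    where
    open ≡-Reasoning
    x = end₁ e
    y = end₂ e

  joins⁺ : ∀ {e a i} → 0 < joins e a i → SameEdge (edge G e) (a , i)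
  joins⁺ pos with +-positive pos
  ... | inj₁ p = let a≡x , i≡y = *-positive p in inj₁ (sym (ind⁺ a≡x) , sym (ind⁺ i≡y))
  ... | inj₂ p = let a≡y , i≡x = *-positive p in inj₂ (sym (ind⁺ i≡x) , sym (ind⁺ a≡y))

  joins-≤1 : ∀ {e} → end₁ e ≢ end₂ e → ∀ a i → joins e a i ≤ 1
  joins-≤1 {e} loopless a i =
    +-≤1 (*-mono-≤ (ind≤1 a (end₁ e)) (ind≤1 i (end₂ e))) (*-mono-≤ (ind≤1 a (end₂ e)) (ind≤1 i (end₁ e)))
         (λ p q → loopless (trans (sym (ind⁺ {a = a} (proj₁ (*-positive p))))
                                  (ind⁺ {a = a} (proj₁ (*-positive q)))))

  degreeIn : (Fin (m G) → ℕ) → Fin n → ℕ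
  degreeIn σ i = sumFin (m G) (λ e → σ e * vecE G e i)

  sumFin-degreeIn : ∀ σ → sumFin n (degreeIn σ) ≡ 2 * sumFin (m G) σ
  sumFin-degreeIn σ = begin
    sumFin n (λ i → sumFin (m G) (λ e → σ e * vecE G e i))
      ≡⟨ sumFin-comm n (m G) _ ⟩
    sumFin (m G) (λ e → sumFin n (λ i → σ e * vecE G e i))
      ≡⟨ sumFin-cong (m G) (λ e → sym (*-distribˡ-sumFin n (σ e) (vecE G e))) ⟩
    sumFin (m G) (λ e → σ e * sumFin n (vecE G e))
      ≡⟨ sumFin-cong (m G) (λ e → trans (cong (σ e *_) (sumFin-vecE e)) (*-comm (σ e) 2)) ⟩
    sumFin (m G) (λ e → 2 * σ e)
      ≡⟨ sym (*-distribˡ-sumFin (m G) 2 σ) ⟩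
    2 * sumFin (m G) σ ∎
    where open ≡-Reasoning

  degreeIn⁺ : ∀ {σ e i} → 0 < σ e → Endpoint i e → 0 < degreeIn σ i
  degreeIn⁺ {σ} {e} {i} σe⁺ i∈e =
    ≤-trans (*-mono-≤ σe⁺ (endpoint⇒vecE⁺ i∈e)) (term≤sumFin (m G) (λ e → σ e * vecE G e i) e)

  module _ (σ : Fin (m G) → ℕ) (σ≤1 : ∀ e → σ e ≤ 1) where

    degreeIn≤degree : ∀ i → degreeIn σ i ≤ degree G i
    degreeIn≤degree i = sumFin-mono-≤ (m G)
      (λ e → ≤-trans (*-monoˡ-≤ (vecE G e i) (σ≤1 e)) (≤-reflexive (*-identityˡ _)))

    centre-endpoint : (∀ e → end₁ e ≢ end₂ e) → ∀ {i} → degreeIn σ i ≡ sumFin (m G) σ →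
      ∀ {e} → 0 < σ e → Endpoint i e
    centre-endpoint loopless {i} deg≡size {e} σe⁺ =
      vecE⁺ {e} {i} (proj₂ (*-positive {σ e}
        (≤-trans σe⁺ (sumFin-tight (m G) σv≤σ (≤-reflexive (sym deg≡size)) e))))
      where
      σv≤σ : ∀ e → σ e * vecE G e i ≤ σ e
      σv≤σ e = ≤-trans (*-monoʳ-≤ (σ e) (vecE-≤1 (loopless e) i)) (≤-reflexive (*-identityʳ (σ e)))

  module _ (simple : Simple G) (triangleFree : TriangleFree G) where

    multiplicity : Fin n → Fin n → ℕ
    multiplicity a i = sumFin (m G) (λ e → joins e a i)

    multiplicity-≤1 : ∀ a i → multiplicity a i ≤ 1
    multiplicity-≤1 a i = sumFin-≤1 (m G) _ (λ e → joins-≤1 (proj₁ simple e) a i)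
      (λ e e′ p q → proj₂ simple e e′ (sameEdge-common (joins⁺ {e} {a} {i} p) (joins⁺ {e′} {a} {i} q)))

    multiplicity⁺ : ∀ {a i} → 0 < multiplicity a i → Adj G a i
    multiplicity⁺ pos = let e , p = sumFin-positive (m G) _ pos in e , joins⁺ p

    module _ (σ : Fin (m G) → ℕ) (σ≤1 : ∀ e → σ e ≤ 1) where

      joinsIn : Fin n → Fin n → ℕ
      joinsIn a i = sumFin (m G) (λ e → σ e * joins e a i)

      degreeIn≡sumFin-joinsIn : ∀ a → degreeIn σ a ≡ sumFin n (joinsIn a)
      degreeIn≡sumFin-joinsIn a = begin
        sumFin (m G) (λ e → σ e * vecE G e a)
          ≡⟨ sumFin-cong (m G) (λ e → cong (σ e *_) (sym (sumFin-joins e a))) ⟩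
        sumFin (m G) (λ e → σ e * sumFin n (joins e a))
          ≡⟨ sumFin-cong (m G) (λ e → *-distribˡ-sumFin n (σ e) (joins e a)) ⟩
        sumFin (m G) (λ e → sumFin n (λ i → σ e * joins e a i))
          ≡⟨ sumFin-comm (m G) n _ ⟩
        sumFin n (joinsIn a) ∎
        where open ≡-Reasoning

      joinsIn≤multiplicity : ∀ a i → joinsIn a i ≤ multiplicity a i
      joinsIn≤multiplicity a i = sumFin-mono-≤ (m G)
        (λ e → ≤-trans (*-monoˡ-≤ (joins e a i) (σ≤1 e)) (≤-reflexive (*-identityˡ _)))

      joinsIn⁺ : ∀ a {i} → 0 < joinsIn a i → 0 < degreeIn σ i
      joinsIn⁺ a {i} pos =
        let e , p = sumFin-positive (m G) (λ e → σ e * joins e a i) pos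
            σe⁺ , joins⁺′ = *-positive {σ e} p
        in degreeIn⁺ {σ} σe⁺ (sameEdge⇒endpoint (joins⁺ {e} {a} joins⁺′))

      -- The neighbourhoods of adjacent a and b are disjoint (no triangles) and each
      -- neighbour is reached by a single edge (no parallel edges).
      adjacent-degreeIn≤support : ∀ {a b} → Adj G a b →
        degreeIn σ a + degreeIn σ b ≤ sumFin n (λ i → degreeIn σ i ⊓ 1)
      adjacent-degreeIn≤support {a} {b} ab = begin
        degreeIn σ a + degreeIn σ b
          ≡⟨ cong₂ _+_ (degreeIn≡sumFin-joinsIn a) (degreeIn≡sumFin-joinsIn b) ⟩
        sumFin n (joinsIn a) + sumFin n (joinsIn b)
          ≡⟨ sym (sumFin-distrib-+ n _ _) ⟩
        sumFin n (λ i → joinsIn a i + joinsIn b i)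
          ≤⟨ sumFin-mono-≤ n (λ i → ⊓-glb (≤1⇒≤ (joins≤1 i) (positive i)) (joins≤1 i)) ⟩
        sumFin n (λ i → degreeIn σ i ⊓ 1) ∎
        where
        open ≤-Reasoning
        joins≤1 : ∀ i → joinsIn a i + joinsIn b i ≤ 1
        joins≤1 i = ≤-trans (+-mono-≤ (joinsIn≤multiplicity a i) (joinsIn≤multiplicity b i))
          (+-≤1 (multiplicity-≤1 a i) (multiplicity-≤1 b i)
                (λ p q → triangleFree a b i ab (multiplicity⁺ q) (multiplicity⁺ p)))
        positive : ∀ i → 0 < joinsIn a i + joinsIn b i → 0 < degreeIn σ i
        positive i pos = Sum.[ joinsIn⁺ a , joinsIn⁺ b ] (+-positive pos)

      sumFin-degreeIn²≤ : sumFin n (λ i → degreeIn σ i * degreeIn σ i)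
                            ≤ sumFin n (λ i → degreeIn σ i ⊓ 1) * sumFin (m G) σ
      sumFin-degreeIn²≤ = begin
        sumFin n (λ i → d i * d i)
          ≡⟨ sumFin-cong n (λ i → *-distribˡ-sumFin (m G) (d i) _) ⟩
        sumFin n (λ i → sumFin (m G) (λ e → d i * (σ e * vecE G e i)))
          ≡⟨ sumFin-comm n (m G) _ ⟩
        sumFin (m G) (λ e → sumFin n (λ i → d i * (σ e * vecE G e i)))
          ≡⟨ sumFin-cong (m G) (λ e → trans (sumFin-cong n (λ i → *-left-comm (d i) (σ e) _))
                                           (sym (*-distribˡ-sumFin n (σ e) _))) ⟩
        sumFin (m G) (λ e → σ e * sumFin n (λ i → d i * vecE G e i))
          ≡⟨ sumFin-cong (m G) (λ e → cong (σ e *_) (sumFin-*-vecE d e)) ⟩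
        sumFin (m G) (λ e → σ e * (d (end₁ e) + d (end₂ e)))
          ≤⟨ sumFin-mono-≤ (m G) (λ e → *-monoʳ-≤ (σ e) (adjacent-degreeIn≤support (e , inj₁ (refl , refl)))) ⟩
        sumFin (m G) (λ e → σ e * supportSize)
          ≡⟨ trans (sumFin-cong (m G) (λ e → *-comm (σ e) supportSize))
                   (sym (*-distribˡ-sumFin (m G) supportSize σ)) ⟩
        supportSize * sumFin (m G) σ ∎
        where
        open ≤-Reasoning
        d = degreeIn σ
        supportSize = sumFin n (λ i → d i ⊓ 1)

      module _ (maxDegree : MaxDegreeAtMost3 G) where

        private
          d : Fin n → ℕ
          d = degreeIn σ
          size : ℕ
          size = sumFin (m G) σ
          d≤3 : ∀ i → d i ≤ 3
          d≤3 i = ≤-trans (degreeIn≤degree σ σ≤1 i) (maxDegree i)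
          n₁ n₂ n₃ : ℕ
          n₁ = count d 1
          n₂ = count d 2
          n₃ = count d 3

        handshake-byValue : n₁ + 2 * n₂ + 3 * n₃ ≡ 2 * size
        handshake-byValue = begin
          n₁ + 2 * n₂ + 3 * n₃     ≡⟨ cong (λ x → x + 2 * n₂ + 3 * n₃) (sym (*-identityˡ n₁)) ⟩
          1 * n₁ + 2 * n₂ + 3 * n₃ ≡⟨ sym (sumFin-byValue (λ x → x) d d≤3 refl) ⟩
          sumFin n d               ≡⟨ sumFin-degreeIn σ ⟩
          2 * size                 ∎
          where open ≡-Reasoning

        squares-byValue≤ : n₁ + 4 * n₂ + 9 * n₃ ≤ (n₁ + n₂ + n₃) * size
        squares-byValue≤ = begin
          n₁ + 4 * n₂ + 9 * n₃
            ≡⟨ cong (λ x → x + 4 * n₂ + 9 * n₃) (sym (*-identityˡ n₁)) ⟩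
          1 * n₁ + 4 * n₂ + 9 * n₃
            ≡⟨ sym (sumFin-byValue (λ x → x * x) d d≤3 refl) ⟩
          sumFin n (λ i → d i * d i)
            ≤⟨ sumFin-degreeIn²≤ ⟩
          sumFin n (λ i → d i ⊓ 1) * size
            ≡⟨ cong (_* size) (sumFin-byValue (_⊓ 1) d d≤3 refl) ⟩
          (1 * n₁ + 1 * n₂ + 1 * n₃) * size
            ≡⟨ cong (_* size) (cong₂ _+_ (cong₂ _+_ (*-identityˡ n₁) (*-identityˡ n₂)) (*-identityˡ n₃)) ⟩
          (n₁ + n₂ + n₃) * size ∎
          where open ≤-Reasoning

        prodFin-^-byValue : prodFin n (λ i → d i ^ d i) ≡ 4 ^ n₂ * 27 ^ n₃
        prodFin-^-byValue = begin
          prodFin n (λ i → d i ^ d i) ≡⟨ prodFin-byValue (λ x → x ^ x) d d≤3 refl ⟩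
          1 ^ n₁ * 4 ^ n₂ * 27 ^ n₃   ≡⟨ cong (λ x → x * 4 ^ n₂ * 27 ^ n₃) (^-zeroˡ n₁) ⟩
          1 * 4 ^ n₂ * 27 ^ n₃        ≡⟨ cong (_* 27 ^ n₃) (*-identityˡ (4 ^ n₂)) ⟩
          4 ^ n₂ * 27 ^ n₃            ∎
          where open ≡-Reasoning

        impurityOfCounts : ∀ {x} → StarImpurityBound (4 ^ n₂ * 27 ^ n₃) (2 * size) size x →
          StarImpurityBound (prodFin n (λ i → d i ^ d i)) (sumFin n d) size x
        impurityOfCounts {x} = subst₂ (λ D N → StarImpurityBound D N size x)
          (sym prodFin-^-byValue) (sym (sumFin-degreeIn σ))

        record StarOrBonus : Set where
          field
            centres bonus : ℕ
            coverWeight   : Fin n → ℕ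
            centres≤1     : centres ≤ 1
            size≤         : size ≤ 3 * centres + bonus
            coverWeight≤  : sumFin n coverWeight ≤ centres + 2 * bonus
            covers        : ∀ e → 0 < σ e → 0 < coverWeight (end₁ e) ⊎ 0 < coverWeight (end₂ e)
            impurity      : StarImpurityBound (prodFin n (λ i → d i ^ d i)) (sumFin n d) size bonus

        starOrBonus : StarOrBonus
        starOrBonus with Fin.any? (λ i → d i ≟ size)
        ... | yes (centre , d≡size) = record
          { centres      = 1
          ; bonus        = 0
          ; coverWeight  = λ i → ind i centre
          ; centres≤1    = ≤-refl
          ; size≤        = ≤-trans (≤-reflexive (sym d≡size)) (d≤3 centre)
          ; coverWeight≤ = ≤-reflexive (sumFin-ind n centre)
          ; covers       = λ e σe⁺ →
              Sum.map centre⁺ centre⁺ (centre-endpoint σ σ≤1 (proj₁ simple) d≡size σe⁺)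
          ; impurity     = impurityOfCounts {0}
              (starImpurity {size} {n₁} {n₂} {n₃} handshake-byValue squares-byValue≤)
          }
          where
          centre⁺ : ∀ {i} → centre ≡ i → 0 < ind i centre
          centre⁺ refl = ≤-reflexive (sym (ind-refl centre))
        ... | no notStar = record
          { centres      = 0
          ; bonus        = size
          ; coverWeight  = d
          ; centres≤1    = z≤n
          ; size≤        = ≤-refl
          ; coverWeight≤ = ≤-reflexive (sumFin-degreeIn σ)
          ; covers       = λ e σe⁺ → inj₁ (degreeIn⁺ {σ} {e} σe⁺ (inj₁ refl))
          ; impurity     = impurityOfCounts {size}
              (nonStarImpurity {size} {n₁} {n₂} {n₃} handshake-byValue squares-byValue≤
                               (absent 1 , absent 2 , absent 3))
          }
          where
          absent : ∀ v → size ≡ v → count d v ≡ 0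
          absent v size≡v = count-zero d v (λ i di≡v → notStar (i , trans di≡v (sym size≡v)))

-- Combining the clusters

prodFin-StarImpurityBound : ∀ k (D N e x : Fin k → ℕ) →
  (∀ j → StarImpurityBound (D j) (N j) (e j) (x j)) →
  prodFin k D ^ 10 * 2 ^ (sumFin k x + k * 60) * 3 ^ (30 * sumFin k e)
    ≤ prodFin k (λ j → N j ^ N j) ^ 10 * 3 ^ (k * 60)
prodFin-StarImpurityBound k D N e x bounds = subst₂ _≤_ lhs rhs (prodFin-mono-≤ k bounds)
  where
  open ≡-Reasoning
  lhs : prodFin k (λ j → D j ^ 10 * 2 ^ (x j + 60) * 3 ^ (30 * e j))
        ≡ prodFin k D ^ 10 * 2 ^ (sumFin k x + k * 60) * 3 ^ (30 * sumFin k e)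
  lhs = begin
    prodFin k (λ j → D j ^ 10 * 2 ^ (x j + 60) * 3 ^ (30 * e j))
      ≡⟨ prodFin-distrib-* k _ _ ⟩
    prodFin k (λ j → D j ^ 10 * 2 ^ (x j + 60)) * prodFin k (λ j → 3 ^ (30 * e j))
      ≡⟨ cong₂ _*_ (prodFin-distrib-* k _ _) (prodFin-pow k 3 _) ⟩
    prodFin k (λ j → D j ^ 10) * prodFin k (λ j → 2 ^ (x j + 60)) * 3 ^ sumFin k (λ j → 30 * e j)
      ≡⟨ cong₂ _*_ (cong₂ _*_ (prodFin-^ k D 10) (prodFin-pow k 2 _))
                   (cong (3 ^_) (sym (*-distribˡ-sumFin k 30 e))) ⟩
    prodFin k D ^ 10 * 2 ^ sumFin k (λ j → x j + 60) * 3 ^ (30 * sumFin k e)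
      ≡⟨ cong (λ s → prodFin k D ^ 10 * 2 ^ s * 3 ^ (30 * sumFin k e))
              (trans (sumFin-distrib-+ k x (λ _ → 60)) (cong (sumFin k x +_) (sumFin-const k 60))) ⟩
    prodFin k D ^ 10 * 2 ^ (sumFin k x + k * 60) * 3 ^ (30 * sumFin k e) ∎
  rhs : prodFin k (λ j → (N j ^ N j) ^ 10 * 3 ^ 60) ≡ prodFin k (λ j → N j ^ N j) ^ 10 * 3 ^ (k * 60)
  rhs = begin
    prodFin k (λ j → (N j ^ N j) ^ 10 * 3 ^ 60)
      ≡⟨ prodFin-distrib-* k _ _ ⟩
    prodFin k (λ j → (N j ^ N j) ^ 10) * prodFin k (λ _ → 3 ^ 60)
      ≡⟨ cong₂ _*_ (prodFin-^ k _ 10) (trans (prodFin-pow k 3 (λ _ → 60)) (cong (3 ^_) (sumFin-const k 60))) ⟩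
    prodFin k (λ j → N j ^ N j) ^ 10 * 3 ^ (k * 60) ∎

cover-tradeoff : ∀ {k p q s t M} → s ≤ k → k * (q + p) ≤ q * (s + 2 * t) → M ≤ 3 * s + t →
  5 * (M * p) ≤ t * (30 * q + 5 * p)
cover-tradeoff {k} {p} {q} {s} {t} {M} s≤k cover M≤ = begin
  5 * (M * p)                 ≤⟨ *-monoʳ-≤ 5 (*-monoˡ-≤ p M≤) ⟩
  5 * ((3 * s + t) * p)       ≡⟨ expand s t p ⟩
  15 * (p * s) + 5 * t * p    ≤⟨ +-monoˡ-≤ (5 * t * p) (*-monoʳ-≤ 15 ps≤2qt) ⟩
  15 * (q * (2 * t)) + 5 * t * p ≡⟨ collect q t p ⟩
  t * (30 * q + 5 * p)        ∎
  where
  open ≤-Reasoning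
  expand : ∀ s t p → 5 * ((3 * s + t) * p) ≡ 15 * (p * s) + 5 * t * p
  expand = solve-∀
  collect : ∀ q t p → 15 * (q * (2 * t)) + 5 * t * p ≡ t * (30 * q + 5 * p)
  collect = solve-∀
  split : ∀ k q p → k * (q + p) ≡ q * k + p * k
  split = solve-∀
  pk≤2qt : p * k ≤ q * (2 * t)
  pk≤2qt = +-cancelˡ-≤ (q * k) _ _ (begin
    q * k + p * k     ≡⟨ sym (split k q p) ⟩
    k * (q + p)       ≤⟨ cover ⟩
    q * (s + 2 * t)   ≡⟨ *-distribˡ-+ q s (2 * t) ⟩
    q * s + q * (2 * t) ≤⟨ +-monoˡ-≤ (q * (2 * t)) (*-monoʳ-≤ q s≤k) ⟩
    q * k + q * (2 * t) ∎)
  ps≤2qt : p * s ≤ q * (2 * t)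
  ps≤2qt = ≤-trans (*-monoʳ-≤ p s≤k) pk≤2qt

3^3x≤2^5x : ∀ x → 3 ^ (3 * x) ≤ 2 ^ (5 * x)
3^3x≤2^5x x = begin
  3 ^ (3 * x) ≡⟨ sym (^-*-assoc 3 3 x) ⟩
  27 ^ x      ≤⟨ ^-monoˡ-≤ x (≤ᵇ⇒≤ 27 32 tt) ⟩
  32 ^ x      ≡⟨ ^-*-assoc 2 5 x ⟩
  2 ^ (5 * x) ∎
  where open ≤-Reasoning

*-^-cancelʳ-≤ : ∀ x y z a b c .{{_ : NonZero z}} →
  x * z ^ (a + c) ≤ y * z ^ (b + c) → x * z ^ a ≤ y * z ^ b
*-^-cancelʳ-≤ x y z a b c le =
  *-cancelʳ-≤ (x * z ^ a) (y * z ^ b) (z ^ c) {{m^n≢0 z c}} (subst₂ _≤_ (split x a) (split y b) le)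
  where
  split : ∀ w a → w * z ^ (a + c) ≡ w * z ^ a * z ^ c
  split w a = trans (cong (w *_) (^-distribˡ-+-* z a c)) (sym (*-assoc w (z ^ a) (z ^ c)))

*-^-∸-cancel : ∀ x y z m n .{{_ : NonZero z}} →
  x * z ^ m ≤ y * z ^ n → x * z ^ (m ∸ n) ≤ y * z ^ (n ∸ m)
*-^-∸-cancel x y z m n le with ≤-total m n
... | inj₁ m≤n rewrite m≤n⇒m∸n≡0 m≤n =
  *-^-cancelʳ-≤ x y z 0 (n ∸ m) m (subst (λ e → x * z ^ m ≤ y * z ^ e) (sym (m∸n+n≡m m≤n)) le)
... | inj₂ n≤m rewrite m≤n⇒m∸n≡0 n≤m =
  *-^-cancelʳ-≤ x y z (m ∸ n) 0 n (subst (λ e → x * z ^ e ≤ y * z ^ n) (sym (m∸n+n≡m n≤m)) le)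

*-distribˡʳ-∸ : ∀ a b c u → a * (b ∸ c) * u ≡ a * b * u ∸ a * c * u
*-distribˡʳ-∸ a b c u = trans (cong (_* u) (*-distribˡ-∸ a b c)) (*-distribʳ-∸ u (a * b) (a * c))

^-distribʳ-*-^ : ∀ a x y B → (a * x ^ y) ^ B ≡ a ^ B * x ^ (y * B)
^-distribʳ-*-^ a x y B = trans (^-distribʳ-* a (x ^ y) B) (cong (a ^ B *_) (^-*-assoc x y B))

power-of-bound : ∀ {D N k M t} B →
  D ^ 10 * 2 ^ (t + k * 60) * 3 ^ (30 * M) ≤ N ^ 10 * 3 ^ (k * 60) →
  D ^ (10 * B) * (2 ^ (t * B) * 2 ^ (k * 60 * B)) * 3 ^ (30 * M * B) ≤ N ^ (10 * B) * 3 ^ (k * 60 * B)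
power-of-bound {D} {N} {k} {M} {t} B bound = subst₂ _≤_ lhs rhs (^-monoˡ-≤ B bound)
  where
  lhs : (D ^ 10 * 2 ^ (t + k * 60) * 3 ^ (30 * M)) ^ B
        ≡ D ^ (10 * B) * (2 ^ (t * B) * 2 ^ (k * 60 * B)) * 3 ^ (30 * M * B)
  lhs = trans (^-distribʳ-*-^ _ 3 (30 * M) B) (cong (_* 3 ^ (30 * M * B))
          (trans (^-distribʳ-*-^ (D ^ 10) 2 (t + k * 60) B)
                 (cong₂ _*_ (^-*-assoc D 10 B)
                            (trans (cong (2 ^_) (*-distribʳ-+ B t (k * 60)))
                                   (^-distribˡ-+-* 2 (t * B) (k * 60 * B))))))
  rhs : (N ^ 10 * 3 ^ (k * 60)) ^ B ≡ N ^ (10 * B) * 3 ^ (k * 60 * B)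
  rhs = trans (^-distribʳ-*-^ (N ^ 10) 3 (k * 60) B) (cong (_* 3 ^ (k * 60 * B)) (^-*-assoc N 10 B))

-- In base-2 logarithms, with I the total impurity, the hypothesis says 10 I ≥ 10 κ + t where
-- κ = 6 k + 3 (M - 2 k) log 3 < 5 M, and the conclusion says 10 B I ≥ (p + 10 B) κ.
impurity-scaled : ∀ {D N k M t} p B →
  D ^ 10 * 2 ^ (t + k * 60) * 3 ^ (30 * M) ≤ N ^ 10 * 3 ^ (k * 60) →
  5 * (M * p) ≤ t * B →
  D ^ (10 * B) * 2 ^ (6 * k * (p + 10 * B)) * 3 ^ (3 * M * (p + 10 * B))
    ≤ N ^ (10 * B) * 3 ^ (3 * (2 * k) * (p + 10 * B))
impurity-scaled {D} {N} {k} {M} {t} p B bound tradeoff = begin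
  D ^ (10 * B) * 2 ^ (6 * k * (p + 10 * B)) * 3 ^ (3 * M * (p + 10 * B))
    ≡⟨ cong₂ (λ a b → D ^ (10 * B) * a * b)
             (trans (cong (2 ^_) (split₂ k p B)) (^-distribˡ-+-* 2 (k * 60 * B) (6 * k * p)))
             (trans (cong (3 ^_) (split₃ M p B)) (^-distribˡ-+-* 3 (30 * M * B) (3 * (M * p)))) ⟩
  D ^ (10 * B) * (2 ^ (k * 60 * B) * 2 ^ (6 * k * p)) * (3 ^ (30 * M * B) * 3 ^ (3 * (M * p)))
    ≡⟨ regroup₁ (D ^ (10 * B)) (2 ^ (k * 60 * B)) (2 ^ (6 * k * p)) (3 ^ (30 * M * B)) (3 ^ (3 * (M * p))) ⟩
  D ^ (10 * B) * 2 ^ (k * 60 * B) * 3 ^ (30 * M * B) * (2 ^ (6 * k * p) * 3 ^ (3 * (M * p)))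
    ≤⟨ *-monoʳ-≤ (D ^ (10 * B) * 2 ^ (k * 60 * B) * 3 ^ (30 * M * B))
         (*-mono-≤ (^-monoˡ-≤ (6 * k * p) (≤ᵇ⇒≤ 2 3 tt))
                   (≤-trans (3^3x≤2^5x (M * p)) (^-monoʳ-≤ 2 tradeoff))) ⟩
  D ^ (10 * B) * 2 ^ (k * 60 * B) * 3 ^ (30 * M * B) * (3 ^ (6 * k * p) * 2 ^ (t * B))
    ≡⟨ regroup₂ (D ^ (10 * B)) (2 ^ (k * 60 * B)) (3 ^ (30 * M * B)) (3 ^ (6 * k * p)) (2 ^ (t * B)) ⟩
  D ^ (10 * B) * (2 ^ (t * B) * 2 ^ (k * 60 * B)) * 3 ^ (30 * M * B) * 3 ^ (6 * k * p)
    ≤⟨ *-monoˡ-≤ (3 ^ (6 * k * p)) (power-of-bound {D} {N} {k} {M} {t} B bound) ⟩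
  N ^ (10 * B) * 3 ^ (k * 60 * B) * 3 ^ (6 * k * p)
    ≡⟨ trans (*-assoc (N ^ (10 * B)) _ _) (cong (N ^ (10 * B) *_)
         (trans (sym (^-distribˡ-+-* 3 (k * 60 * B) (6 * k * p))) (cong (3 ^_) (sym (split₆ k p B))))) ⟩
  N ^ (10 * B) * 3 ^ (3 * (2 * k) * (p + 10 * B)) ∎
  where
  open ≤-Reasoning
  split₂ : ∀ k p B → 6 * k * (p + 10 * B) ≡ k * 60 * B + 6 * k * p
  split₂ = solve-∀
  split₃ : ∀ M p B → 3 * M * (p + 10 * B) ≡ 30 * M * B + 3 * (M * p)
  split₃ = solve-∀
  split₆ : ∀ k p B → 3 * (2 * k) * (p + 10 * B) ≡ k * 60 * B + 6 * k * p
  split₆ = solve-∀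
  regroup₁ : ∀ a b c d e → a * (b * c) * (d * e) ≡ a * b * d * (c * e)
  regroup₁ = solve-∀
  regroup₂ : ∀ a b c d e → a * b * c * (d * e) ≡ a * (e * b) * c * d
  regroup₂ = solve-∀

impurity-amplify : ∀ {D N k M t} p B →
  D ^ 10 * 2 ^ (t + k * 60) * 3 ^ (30 * M) ≤ N ^ 10 * 3 ^ (k * 60) →
  5 * (M * p) ≤ t * B →
  D ^ (10 * B) * 2 ^ (6 * k * (p + 10 * B)) * 3 ^ (3 * (M ∸ 2 * k) * (p + 10 * B))
    ≤ N ^ (10 * B) * 3 ^ (3 * (2 * k ∸ M) * (p + 10 * B))
impurity-amplify {D} {N} {k} {M} {t} p B bound tradeoff =
  subst₂ _≤_ (cong (λ e → D ^ (10 * B) * 2 ^ (6 * k * u) * 3 ^ e) (sym (*-distribˡʳ-∸ 3 M (2 * k) u)))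
             (cong (λ e → N ^ (10 * B) * 3 ^ e) (sym (*-distribˡʳ-∸ 3 (2 * k) M u)))
             (*-^-∸-cancel (D ^ (10 * B) * 2 ^ (6 * k * u)) (N ^ (10 * B)) 3 (3 * M * u) (3 * (2 * k) * u)
                           (impurity-scaled {D} {N} {k} {M} {t} p B bound tradeoff))
  where
  u = p + 10 * B

module _ {n} {G : Graph n} (simple : Simple G) (triangleFree : TriangleFree G)
         (maxDegree : MaxDegreeAtMost3 G) {k} (c : Clustering G k) where

  private
    member : Fin k → Fin (m G) → ℕ
    member j e = ind (c e) j

    summary : (j : Fin k) → StarOrBonus G simple triangleFree (member j) (λ e → ind≤1 (c e) j) maxDegree
    summary j = starOrBonus G simple triangleFree (member j) (λ e → ind≤1 (c e) j) maxDegree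

    open module Summary j = StarOrBonus (summary j)

  clusterVec≡degreeIn : ∀ j i → clusterVec G c j i ≡ degreeIn G (member j) i
  clusterVec≡degreeIn j i = sumFin-cong (m G) (λ e → select≡ind-* (c e) j (vecE G e i))
    where
    select≡ind-* : ∀ {k} (a b : Fin k) x → (if ⌊ a Fin.≟ b ⌋ then x else 0) ≡ ind a b * x
    select≡ind-* a b x with a Fin.≟ b
    ... | yes _ = sym (+-identityʳ x)
    ... | no  _ = refl

  sumFin-clusterSizes : sumFin k (λ j → sumFin (m G) (member j)) ≡ m G
  sumFin-clusterSizes = begin
    sumFin k (λ j → sumFin (m G) (λ e → ind (c e) j))
      ≡⟨ sumFin-comm k (m G) _ ⟩
    sumFin (m G) (λ e → sumFin k (λ j → ind (c e) j))
      ≡⟨ sumFin-cong (m G) (λ e → trans (sumFin-cong k (λ j → ind-comm (c e) j)) (sumFin-ind k (c e))) ⟩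
    sumFin (m G) (λ _ → 1)
      ≡⟨ trans (sumFin-const (m G) 1) (*-identityʳ (m G)) ⟩
    m G ∎
    where open ≡-Reasoning

  clustering-impurity : ∀ {p q} → CoverBound G k p q → ImpAtLeastKappa G c p (10 * (30 * q + 5 * p))
  clustering-impurity {p} {q} coverBound =
    impurity-amplify {impDen G c} {impNum G c} {k} {m G} {t} p (30 * q + 5 * p) aggregated tradeoff
    where
    s t : ℕ
    s = sumFin k centres
    t = sumFin k bonus

    ρ : Fin n → ℕ
    ρ i = sumFin k (λ j → coverWeight j i)

    covered : ∀ e → 0 < ρ (end₁ G e) ⊎ 0 < ρ (end₂ G e)
    covered e = Sum.map (λ pos → ≤-trans pos (term≤sumFin k (λ j → coverWeight j (end₁ G e)) (c e)))
                        (λ pos → ≤-trans pos (term≤sumFin k (λ j → coverWeight j (end₂ G e)) (c e)))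
                        (covers (c e) e (≤-reflexive (sym (ind-refl (c e)))))

    sumFin-ρ≤ : sumFin n ρ ≤ s + 2 * t
    sumFin-ρ≤ = begin
      sumFin n ρ                                  ≡⟨ sumFin-comm n k _ ⟩
      sumFin k (λ j → sumFin n (coverWeight j))   ≤⟨ sumFin-mono-≤ k coverWeight≤ ⟩
      sumFin k (λ j → centres j + 2 * bonus j)    ≡⟨ trans (sumFin-distrib-+ k _ _)
                                                       (cong (s +_) (sym (*-distribˡ-sumFin k 2 bonus))) ⟩
      s + 2 * t                                   ∎
      where open ≤-Reasoning

    s≤k : s ≤ k
    s≤k = ≤-trans (sumFin-mono-≤ k centres≤1) (≤-reflexive (trans (sumFin-const k 1) (*-identityʳ k)))

    m≤3s+t : m G ≤ 3 * s + t
    m≤3s+t = begin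
      m G                                         ≡⟨ sym sumFin-clusterSizes ⟩
      sumFin k (λ j → sumFin (m G) (member j))    ≤⟨ sumFin-mono-≤ k size≤ ⟩
      sumFin k (λ j → 3 * centres j + bonus j)    ≡⟨ trans (sumFin-distrib-+ k _ _)
                                                       (cong (_+ t) (sym (*-distribˡ-sumFin k 3 centres))) ⟩
      3 * s + t                                   ∎
      where open ≤-Reasoning

    tradeoff : 5 * (m G * p) ≤ t * (30 * q + 5 * p)
    tradeoff = cover-tradeoff {k} {p} {q} s≤k
      (≤-trans (coverBound-weighted G {k} {p} {q} coverBound ρ covered) (*-monoʳ-≤ q sumFin-ρ≤)) m≤3s+t

    clusterImpurity : ∀ j → StarImpurityBound (prodFin n (λ i → clusterVec G c j i ^ clusterVec G c j i))
                                              (clusterNorm G c j) (sumFin (m G) (member j)) (bonus j)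
    clusterImpurity j = subst₂ (λ D N → StarImpurityBound D N (sumFin (m G) (member j)) (bonus j))
      (prodFin-cong n (λ i → cong (λ z → z ^ z) (sym (clusterVec≡degreeIn j i))))
      (sumFin-cong n (λ i → sym (clusterVec≡degreeIn j i)))
      (impurity j)

    aggregated : impDen G c ^ 10 * 2 ^ (t + k * 60) * 3 ^ (30 * m G) ≤ impNum G c ^ 10 * 3 ^ (k * 60)
    aggregated = subst (λ M → impDen G c ^ 10 * 2 ^ (t + k * 60) * 3 ^ (30 * M) ≤ impNum G c ^ 10 * 3 ^ (k * 60))
      sumFin-clusterSizes
      (prodFin-StarImpurityBound k _ (clusterNorm G c) (λ j → sumFin (m G) (member j)) bonus clusterImpurity)

lemma3 : ∀ (p q : ℕ) → 0 < p → 0 < q →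
    ∃₂ λ (a b : ℕ) → (0 < a × 0 < b) ×
      (∀ (n : ℕ) (G : Graph n) → Simple G → TriangleFree G → MaxDegreeAtMost3 G →
        ∀ (k : ℕ) → 1 ≤ k → (c : Clustering G k) → MinImpurity G k c →
        CoverBound G k p q → ImpAtLeastKappa G c a b)
lemma3 p q p>0 q>0 = p , 10 * (30 * q + 5 * p) , (p>0 , b>0) ,
  λ n G simple triangleFree maxDegree k _ c _ → clustering-impurity simple triangleFree maxDegree c {p} {q}
  where
  b>0 : 0 < 10 * (30 * q + 5 * p)
  b>0 = ≤-trans p>0 (≤-trans (m≤m+n p (4 * p)) (≤-trans (m≤n+m (5 * p) (30 * q)) (m≤n*m _ 10)))
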